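{- In the comparison query model, no deterministic algorithm can be better than $2$-competitive for the problem of verifying that a given matching $M$ in a stable matching instance with uncertain preferences on both sides is stable.
   Context: Two disjoint sets $A$, $B$ of agents with $|A|=|B|=n$. Each $a\in A$ has a strict total order $\prec_a$ on $B$ and each $b\in B$ has a strict total order $\prec_b$ on $A$ ($x\prec_y z$: $y$ prefers $x$ to $z$). A matching is a bijection between $A$ and $B$; it is stable if there is no pair $(a,b)$, $b\neq M(a)$, with $a$ preferring $b$ to $M(a)$ and $b$ preferring $a$ to $M(b)$. Two-sided uncertainty: all preference orders of agents in $A$ and in $B$ are initially unknown and are learned only via comparison queries: for an agent $x$ and two agents $y_1,y_2$ of the other side, $\mathit{prefer}(x,y_1,y_2)$ returns whichever of $y_1,y_2$ agent $x$ prefers. An algorithm queries adaptively until the answers prove its output correct. It is $\rho$-competitive if its number of queries is at most $\rho$ times the minimum size of a query set whose answers suffice to prove that $M$ is stable; the competitive ratio is measured only on inputs where $M$ is stable. -}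

module Defs where

open import Data.Nat using (ℕ; zero; suc; _*_; _≤_; _<_)
open import Data.Fin using (Fin) renaming (_<_ to _<ᶠ_)
open import Data.Fin.Properties using () renaming (_<?_ to _<ᶠ?_)
open import Data.Fin.Permutation using (Permutation′; _⟨$⟩ʳ_; _⟨$⟩ˡ_)
open import Data.List using (List; []; _∷_; length)
open import Data.List.Membership.Propositional using (_∈_)
open import Data.List.Relation.Unary.All using (All)
open import Data.Product using (_×_; _,_; ∃-syntax)
open import Data.Bool using (Bool; true; false)
open import Data.Maybe using (Maybe; just; nothing)
open import Function.Definitions using (Injective)
open import Relation.Binary.PropositionalEquality using (_≡_; _≢_)
open import Relation.Nullary using (¬_; yes; no)

-- A strict total order on a set of n agents (Fin n), given by a ranking:
-- an injective map agent ↦ position; smaller position = more preferred.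
record Pref (n : ℕ) : Set where
  field
    rank    : Fin n → Fin n
    rank-inj : Injective _≡_ _≡_ rank
open Pref public

_≺[_]_ : ∀ {n} → Fin n → Pref n → Fin n → Set
x ≺[ p ] z = rank p x <ᶠ rank p z

-- A stable matching instance with |A| = |B| = n, A = B = Fin n (two copies).
record Instance (n : ℕ) : Set where
  field
    prefA : Fin n → Pref n
    prefB : Fin n → Pref n
open Instance public

-- A matching: a bijection A → B.
Matching : ℕ → Set
Matching n = Permutation′ n

Stable : ∀ {n} → Instance n → Matching n → Set
Stable {n} I M = ∀ (a b : Fin n) → b ≢ (M ⟨$⟩ʳ a) →
  ¬ ((b ≺[ prefA I a ] (M ⟨$⟩ʳ a)) × (a ≺[ prefB I b ] (M ⟨$⟩ˡ b)))

data Query (n : ℕ) : Set where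
  qA : (a b₁ b₂ : Fin n) → Query n
  qB : (b a₁ a₂ : Fin n) → Query n

better : ∀ {n} → Pref n → Fin n → Fin n → Fin n
better p y₁ y₂ with rank p y₁ <ᶠ? rank p y₂
... | yes _ = y₁
... | no  _ = y₂

answer : ∀ {n} → Instance n → Query n → Fin n
answer I (qA a b₁ b₂) = better (prefA I a) b₁ b₂
answer I (qB b a₁ a₂) = better (prefB I b) a₁ a₂

-- History of queries with their answers (most recent first).
History : ℕ → Set
History n = List (Query n × Fin n)

Consistent : ∀ {n} → Instance n → History n → Set
Consistent I h = All (λ qr → answer I (Data.Product.proj₁ qr) ≡ Data.Product.proj₂ qr) h

ProvesStable : ∀ {n} → Matching n → History n → Set
ProvesStable {n} M h = ∀ (J : Instance n) → Consistent J h → Stable J M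

ProvesUnstable : ∀ {n} → Matching n → History n → Set
ProvesUnstable {n} M h = ∀ (J : Instance n) → Consistent J h → ¬ Stable J M

Certifies : ∀ {n} → Instance n → Matching n → List (Query n) → Set
Certifies {n} I M S = ∀ (J : Instance n) →
  (∀ q → q ∈ S → answer J q ≡ answer I q) → Stable J M

-- One step of a deterministic adaptive algorithm: stop with a verdict
-- (true = "M is stable", false = "M is not stable") or ask a query.
data Step (n : ℕ) : Set where
  stop : Bool → Step n
  ask  : Query n → Step n

Algorithm : Set
Algorithm = (n : ℕ) → Matching n → History n → Step n

run : Algorithm → ∀ {n} → Instance n → Matching n → ℕ → History n →
      Maybe (History n × Bool)
run alg I M zero h = nothing
run alg {n} I M (suc k) h with alg n M h
... | stop v = just (h , v)
... | ask q  = run alg I M k ((q , answer I q) ∷ h)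

Correct : Algorithm → Set
Correct alg = ∀ (n : ℕ) (M : Matching n) (I : Instance n) →
  ∃[ k ] ∃[ h ] ∃[ v ] (run alg I M k [] ≡ just (h , v)
    × (v ≡ true → ProvesStable M h)
    × (v ≡ false → ProvesUnstable M h))

-- (p/q)-competitive: correct, and on every input where M is stable the
-- number of queries is ≤ (p/q)·OPT, i.e. ≤ (p/q)·|S| for every certifying S.
Competitive : ℕ → ℕ → Algorithm → Set
Competitive p q alg = Correct alg ×
  (∀ (n : ℕ) (M : Matching n) (I : Instance n) → Stable I M →
    ∀ k h v → run alg I M k [] ≡ just (h , v) →
    ∀ (S : List (Query n)) → Certifies I M S →
    length h * q ≤ p * length S)

-- The adversary works on two agents per side with M the identity matching. M has exactly two
-- potential blocking pairs, (a₀ , b₁) and (a₁ , b₀), and each agent's whole preference is one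
-- bit: does it prefer its partner in the potential blocking pair to its partner in M? The
-- instances in which every such pair has exactly one deviating agent are stable, and two
-- queries (one to the non-deviating agent of each pair) prove it. The adversary declares the
-- first agent of a pair that the algorithm asks about to be the deviating one. As long as the
-- other agent of that pair has not been asked, making it deviate too is consistent with all
-- answers and makes M unstable, so a correct algorithm asks all four agents: 4 queries against
-- an optimum of 2.
module Submission where

open import Defs
open import Data.Bool using (Bool; true; false; if_then_else_)
open import Data.Empty using (⊥-elim)
open import Data.Fin using (Fin; zero; suc; opposite)
open import Data.Fin.Permutation using () renaming (id to identity)
open import Data.Fin.Properties using (_≟_; opposite-involutive) renaming (_<?_ to _<ᶠ?_; <-asym to <ᶠ-asym)
open import Data.List using (List; []; _∷_; length; filter)
open import Data.List.Properties using (filter-notAll)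
open import Data.List.Membership.Propositional using (_∈_)
open import Data.List.Relation.Unary.All as All using (All; []; _∷_)
open import Data.List.Relation.Unary.AllPairs using ([]; _∷_)
open import Data.List.Relation.Unary.Any as Any using (Any; here; there; any?)
open import Data.List.Relation.Unary.Any.Properties using (filter⁺; lookup-result)
open import Data.List.Relation.Unary.Unique.Propositional using (Unique)
open import Data.Maybe using (Maybe; just; nothing; _<∣>_; fromMaybe)
open import Data.Maybe.Properties using () renaming (≡-dec to ≡-dec-Maybe)
open import Data.Nat using (ℕ; zero; suc; _*_; _≤_; _<_; _⊔_; z≤n; s≤s)
open import Data.Nat.Properties using (≤-<-trans; <-irrefl; m≤m⊔n; m≤n⊔m; *-monoˡ-≤; *-monoˡ-<; *-comm; *-assoc; module ≤-Reasoning)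
open import Data.Product using (_×_; _,_; proj₁; proj₂; ∃-syntax)
open import Data.Product.Properties using () renaming (≡-dec to ≡-dec-×)
open import Data.Sum using ([_,_]′)
open import Function using (_∘_; id)
open import Relation.Binary.Definitions using (DecidableEquality)
open import Relation.Binary.PropositionalEquality using (_≡_; _≢_; refl; sym; trans; cong; subst)
open import Relation.Nullary using (¬_; Dec; yes; no; does; ¬?; contradiction)
open import Relation.Nullary.Decidable using (decidable-stable; dec-true; dec-false)

run-fuel-mono : ∀ alg {n} (I : Instance n) (M : Matching n) {k k'} h {r} →
                k ≤ k' → run alg I M k h ≡ just r → run alg I M k' h ≡ just r
run-fuel-mono alg I M {zero} h _ ()
run-fuel-mono alg {n} I M {suc k} {suc k'} h (s≤s k≤k') ran with alg n M h
... | stop v = ran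
... | ask q  = run-fuel-mono alg I M ((q , answer I q) ∷ h) k≤k' ran

run-consistent : ∀ alg {n} (I : Instance n) (M : Matching n) k {h h' v} →
                 Consistent I h → run alg I M k h ≡ just (h' , v) → Consistent I h'
run-consistent alg I M zero _ ()
run-consistent alg {n} I M (suc k) {h} consistent ran with alg n M h
run-consistent alg I M (suc k) consistent refl | stop v = consistent
... | ask q = run-consistent alg I M k (refl ∷ consistent) ran

Verified : ∀ {n} → Matching n → History n → Bool → Set
Verified M h v = (v ≡ true → ProvesStable M h) × (v ≡ false → ProvesUnstable M h)

VerifiesWithin : Algorithm → ∀ {n} → Matching n → Instance n → ℕ → Set
VerifiesWithin alg M I k = ∃[ h ] ∃[ v ] (run alg I M k [] ≡ just (h , v) × Verified M h v)

verifiesWithin-mono : ∀ alg {n} {M : Matching n} {I k k'} →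
                      k ≤ k' → VerifiesWithin alg M I k → VerifiesWithin alg M I k'
verifiesWithin-mono alg {M = M} {I} k≤k' (h , v , ran , verified) =
  h , v , run-fuel-mono alg I M [] k≤k' ran , verified

stable-verdict : ∀ {n} {M : Matching n} {I h v} →
                 Verified M h v → Consistent I h → Stable I M → v ≡ true
stable-verdict {v = true}          _        _          _      = refl
stable-verdict {I = I} {v = false} verified consistent stable =
  ⊥-elim (proj₂ verified refl I consistent stable)

common-bound : ∀ {X : Set} (P : X → ℕ → Set) → (∀ {x k k'} → k ≤ k' → P x k → P x k') →
               (∀ x → ∃[ k ] P x k) → (xs : List X) → ∃[ K ] All (λ x → P x K) xs
common-bound P mono bound [] = 0 , []
common-bound P mono bound (x ∷ xs) with bound x | common-bound P mono bound xs
... | k , px | K , pxs = k ⊔ K , mono (m≤m⊔n k K) px ∷ All.map (mono (m≤n⊔m k K)) pxs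

module _ {X K : Set} (_≟ᴷ_ : DecidableEquality K) (key : X → K) where

  distinct-keys≤length : ∀ {ks} xs → Unique ks → All (λ k → Any (λ x → key x ≡ k) xs) ks →
                         length ks ≤ length xs
  distinct-keys≤length xs [] [] = z≤n
  distinct-keys≤length {k ∷ ks} xs (k≢ks ∷ unique) (k-occurs ∷ ks-occur) =
    ≤-<-trans (distinct-keys≤length without-k unique (All.zipWith still-occurs (k≢ks , ks-occur)))
              (filter-notAll (λ x → ¬? (key x ≟ᴷ k)) xs (Any.map (λ eq neq → neq eq) k-occurs))
    where
    without-k : List X
    without-k = filter (λ x → ¬? (key x ≟ᴷ k)) xs
    still-occurs : ∀ {k'} → k ≢ k' × Any (λ x → key x ≡ k') xs → Any (λ x → key x ≡ k') without-k
    still-occurs (k≢k' , occurs) =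
      [ id , (λ keyed-k → contradiction (λ eq → k≢k' (trans (sym eq) (lookup-result occurs)))
                                         keyed-k) ]′
      (filter⁺ (λ x → ¬? (key x ≟ᴷ k)) occurs)

data Side : Set where
  A B : Side

other : Side → Side
other A = B
other B = A

other-≢ : ∀ s → other s ≢ s
other-≢ A ()
other-≢ B ()

side-cases : ∀ (P : Side → Set) d → P d → P (other d) → ∀ s → P s
side-cases P A pd po A = pd
side-cases P A pd po B = po
side-cases P B pd po A = po
side-cases P B pd po B = pd

_≟ˢ_ : DecidableEquality Side
A ≟ˢ A = yes refl
A ≟ˢ B = no λ ()
B ≟ˢ A = no λ ()
B ≟ˢ B = yes refl

opposite-≢ : ∀ (i : Fin 2) → opposite i ≢ i
opposite-≢ zero ()
opposite-≢ (suc zero) ()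

-- Slot (i , A) is the agent aᵢ and slot (i , B) the agent b_{1-i}: together the potential
-- blocking pair (aᵢ , b_{1-i}) of the identity matching.
Slot : Set
Slot = Fin 2 × Side

_≟ˢˡ_ : DecidableEquality Slot
_≟ˢˡ_ = ≡-dec-× _≟_ _≟ˢ_

Profile : Set
Profile = Slot → Bool

update : Profile → Slot → Bool → Profile
update f σ b τ = if does (τ ≟ˢˡ σ) then b else f τ

update-≢ : ∀ f σ b τ → τ ≢ σ → update f σ b τ ≡ f τ
update-≢ f σ b τ τ≢σ with τ ≟ˢˡ σ
... | yes τ≡σ = contradiction τ≡σ τ≢σ
... | no  _   = refl

update-≡ : ∀ f σ b → update f σ b σ ≡ b
update-≡ f σ b with σ ≟ˢˡ σ
... | yes _   = refl
... | no  σ≢σ = contradiction refl σ≢σ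

favouring : Fin 2 → Pref 2
favouring zero       = record { rank = id ; rank-inj = id }
favouring (suc zero) = record
  { rank     = opposite
  ; rank-inj = λ {x} {y} eq →
      trans (sym (opposite-involutive x)) (trans (cong opposite eq) (opposite-involutive y))
  }

-- f σ says whether the agent in slot σ prefers its partner in the potential blocking pair.
instanceOf : Profile → Instance 2
instanceOf f = record
  { prefA = λ a → favouring (if f (a , A) then opposite a else a)
  ; prefB = λ b → favouring (if f (opposite b , B) then opposite b else b)
  }

Blocks : Instance 2 → Fin 2 → Set
Blocks I i = opposite i ≺[ prefA I i ] i × i ≺[ prefB I (opposite i) ] opposite i

blocking-pair-unstable : ∀ I i → Blocks I i → ¬ Stable I identity
blocking-pair-unstable I i blocks stable = stable i (opposite i) (opposite-≢ i) blocks

no-blocking-pair-stable : ∀ I → (∀ i → ¬ Blocks I i) → Stable I identity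
no-blocking-pair-stable I safe zero       zero       b≢a = contradiction refl b≢a
no-blocking-pair-stable I safe zero       (suc zero) _   = safe zero
no-blocking-pair-stable I safe (suc zero) zero       _   = safe (suc zero)
no-blocking-pair-stable I safe (suc zero) (suc zero) b≢a = contradiction refl b≢a

deviating-pair-blocks : ∀ f i → (∀ s → f (i , s) ≡ true) → Blocks (instanceOf f) i
deviating-pair-blocks f zero deviates rewrite deviates A | deviates B = s≤s z≤n , s≤s z≤n
deviating-pair-blocks f (suc zero) deviates rewrite deviates A | deviates B = s≤s z≤n , s≤s z≤n

better-self : ∀ {n} (p : Pref n) y → better p y y ≡ y
better-self p y with rank p y <ᶠ? rank p y
... | yes _ = refl
... | no  _ = refl

better-first : ∀ {n} (p : Pref n) {y₁ y₂} → y₁ ≢ y₂ → better p y₁ y₂ ≡ y₁ → ¬ y₂ ≺[ p ] y₁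
better-first p {y₁} {y₂} y₁≢y₂ chosen y₂≺y₁ with rank p y₁ <ᶠ? rank p y₂
... | yes y₁≺y₂ = <ᶠ-asym y₁≺y₂ y₂≺y₁
... | no  _     = y₁≢y₂ (sym chosen)

-- On two agents per side a query between distinct agents reveals exactly one slot of the
-- profile, and a query between an agent and itself reveals nothing.
concerns : Query 2 → Maybe Slot
concerns (qA a b₁ b₂) with b₁ ≟ b₂
... | yes _ = nothing
... | no  _ = just (a , A)
concerns (qB b a₁ a₂) with a₁ ≟ a₂
... | yes _ = nothing
... | no  _ = just (opposite b , B)

answer-determined : ∀ f g q → (∀ σ → concerns q ≡ just σ → f σ ≡ g σ) →
                    answer (instanceOf f) q ≡ answer (instanceOf g) q
answer-determined f g (qA a b₁ b₂) agree with b₁ ≟ b₂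
... | yes refl = trans (better-self _ b₁) (sym (better-self _ b₁))
... | no  _    = cong (λ d → better (favouring (if d then opposite a else a)) b₁ b₂)
                     (agree (a , A) refl)
answer-determined f g (qB b a₁ a₂) agree with a₁ ≟ a₂
... | yes refl = trans (better-self _ a₁) (sym (better-self _ a₁))
... | no  _    = cong (λ d → better (favouring (if d then opposite b else b)) a₁ a₂)
                     (agree (opposite b , B) refl)

Queried : Slot → History 2 → Set
Queried σ h = Any (λ e → concerns (proj₁ e) ≡ just σ) h

queried? : ∀ σ h → Dec (Queried σ h)
queried? σ h = any? (λ e → ≡-dec-Maybe _≟ˢˡ_ (concerns (proj₁ e)) (just σ)) h

agree-on-queried : ∀ f g h → (∀ σ → Queried σ h → f σ ≡ g σ) →
                   Consistent (instanceOf f) h → Consistent (instanceOf g) h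
agree-on-queried f g [] agree [] = []
agree-on-queried f g ((q , r) ∷ h) agree (answered ∷ consistent) =
  trans (sym (answer-determined f g q (λ σ → agree σ ∘ here))) answered
  ∷ agree-on-queried f g h (λ σ → agree σ ∘ there) consistent

four-slots-queried : ∀ {h} → (∀ σ → Queried σ h) → 4 ≤ length h
four-slots-queried {h} queried =
  distinct-keys≤length (≡-dec-Maybe _≟ˢˡ_) (concerns ∘ proj₁) h
    (((λ ()) ∷ (λ ()) ∷ (λ ()) ∷ []) ∷ ((λ ()) ∷ (λ ()) ∷ []) ∷ ((λ ()) ∷ []) ∷ [] ∷ [])
    (queried (zero , A) ∷ queried (zero , B) ∷ queried (suc zero , A) ∷ queried (suc zero , B) ∷ [])

guardQuery : Fin 2 → Side → Query 2
guardQuery i A = qA i i (opposite i)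
guardQuery i B = qB (opposite i) (opposite i) i

partner : Fin 2 → Side → Fin 2
partner i A = i
partner i B = opposite i

guard-answer : ∀ f i s → f (i , s) ≡ false → answer (instanceOf f) (guardQuery i s) ≡ partner i s
guard-answer f zero       A loyal rewrite loyal = refl
guard-answer f zero       B loyal rewrite loyal = refl
guard-answer f (suc zero) A loyal rewrite loyal = refl
guard-answer f (suc zero) B loyal rewrite loyal = refl

guarded-pair-safe : ∀ J i s → answer J (guardQuery i s) ≡ partner i s → ¬ Blocks J i
guarded-pair-safe J i A loyal (a-deviates , _) =
  better-first (prefA J i) (opposite-≢ i ∘ sym) loyal a-deviates
guarded-pair-safe J i B loyal (_ , b-deviates) =
  better-first (prefB J (opposite i)) (opposite-≢ i) loyal b-deviates

-- A configuration names, for each potential blocking pair, its one deviating agent.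
Config : Set
Config = Side × Side

deviant : Config → Fin 2 → Side
deviant (d , _) zero       = d
deviant (_ , d) (suc zero) = d

allConfigs : List Config
allConfigs = (A , A) ∷ (A , B) ∷ (B , A) ∷ (B , B) ∷ []

∈-allConfigs : ∀ c → c ∈ allConfigs
∈-allConfigs (A , A) = here refl
∈-allConfigs (A , B) = there (here refl)
∈-allConfigs (B , A) = there (there (here refl))
∈-allConfigs (B , B) = there (there (there (here refl)))

deviation : Config → Profile
deviation c (i , s) = does (s ≟ˢ deviant c i)

configInstance : Config → Instance 2
configInstance c = instanceOf (deviation c)

deviation-deviant : ∀ c i → deviation c (i , deviant c i) ≡ true
deviation-deviant c i = dec-true (deviant c i ≟ˢ deviant c i) refl

deviation-other : ∀ c i → deviation c (i , other (deviant c i)) ≡ false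
deviation-other c i = dec-false (other (deviant c i) ≟ˢ deviant c i) (other-≢ (deviant c i))

guard : Config → Fin 2 → Query 2
guard c i = guardQuery i (other (deviant c i))

certificate : Config → List (Query 2)
certificate c = guard c zero ∷ guard c (suc zero) ∷ []

guard∈certificate : ∀ c i → guard c i ∈ certificate c
guard∈certificate c zero       = here refl
guard∈certificate c (suc zero) = there (here refl)

certifies : ∀ c → Certifies (configInstance c) identity (certificate c)
certifies c J agrees = no-blocking-pair-stable J λ i →
  guarded-pair-safe J i (other (deviant c i))
    (trans (agrees (guard c i) (guard∈certificate c i))
           (guard-answer (deviation c) i (other (deviant c i)) (deviation-other c i)))

configInstance-stable : ∀ c → Stable (configInstance c) identity
configInstance-stable c = certifies c (configInstance c) (λ _ _ → refl)

blockedAt : Config → Fin 2 → Profile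
blockedAt c i = update (deviation c) (i , other (deviant c i)) true

blockedAt-blocks : ∀ c i → Blocks (instanceOf (blockedAt c i)) i
blockedAt-blocks c i = deviating-pair-blocks (blockedAt c i) i
  (side-cases (λ s → blockedAt c i (i , s) ≡ true) (deviant c i)
    (trans (update-≢ (deviation c) guardSlot true (i , deviant c i)
                     (other-≢ (deviant c i) ∘ sym ∘ cong proj₂))
           (deviation-deviant c i))
    (update-≡ (deviation c) guardSlot true))
  where
  guardSlot : Slot
  guardSlot = (i , other (deviant c i))

unasked-guard-allows-blocking : ∀ c h i → ¬ Queried (i , other (deviant c i)) h →
                                Consistent (configInstance c) h → ¬ ProvesStable identity h
unasked-guard-allows-blocking c h i unasked consistent proves =
  blocking-pair-unstable (instanceOf (blockedAt c i)) i (blockedAt-blocks c i)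
    (proves (instanceOf (blockedAt c i))
            (agree-on-queried (deviation c) (blockedAt c i) h agree consistent))
  where
  agree : ∀ σ → Queried σ h → deviation c σ ≡ blockedAt c i σ
  agree σ queried =
    sym (update-≢ (deviation c) (i , other (deviant c i)) true σ λ { refl → unasked queried })

sideQueried : Query 2 → Fin 2 → Maybe Side
sideQueried q i with concerns q
... | nothing      = nothing
... | just (j , s) = if does (j ≟ i) then just s else nothing

sideQueried-sound : ∀ q i {s} → sideQueried q i ≡ just s → concerns q ≡ just (i , s)
sideQueried-sound q i eq with concerns q
... | just (j , t) with j ≟ i
sideQueried-sound q i refl | just (j , t) | yes refl = refl

sideQueried-complete : ∀ q i {s} → concerns q ≡ just (i , s) → sideQueried q i ≡ just s
sideQueried-complete q i eq with concerns q
sideQueried-complete q i refl | just (i , s) with i ≟ i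
... | yes _   = refl
... | no  i≢i = contradiction refl i≢i

-- Histories are most recent first, so `<∣>` keeps the side of the earliest query about pair i:
-- this is the side the adversary commits to be the deviating one.
commitAfter : Query 2 → History 2 → Fin 2 → Maybe Side
commitment  : History 2 → Fin 2 → Maybe Side
commitAfter q h i = commitment h i <∣> sideQueried q i
commitment []            = λ _ → nothing
commitment ((q , _) ∷ h) = commitAfter q h

committed-queried : ∀ h i {s} → commitment h i ≡ just s → Queried (i , s) h
committed-queried ((q , _) ∷ h) i eq with commitment h i in earlier
... | just t  = there (committed-queried h i (trans earlier eq))
... | nothing = here (sideQueried-sound q i eq)

concerned-committed : ∀ q h i {s} → concerns q ≡ just (i , s) → ∃[ t ] commitAfter q h i ≡ just t
concerned-committed q h i concerned with commitment h i
... | just t  = t , refl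
... | nothing = _ , sideQueried-complete q i concerned

queried-committed : ∀ h i {s} → Queried (i , s) h → ∃[ t ] commitment h i ≡ just t
queried-committed ((q , _) ∷ h) i (there queried) with queried-committed h i queried
... | t , committed rewrite committed = t , refl
queried-committed ((q , _) ∷ h) i (here concerned) = concerned-committed q h i concerned

Respects : Config → (Fin 2 → Maybe Side) → Set
Respects c m = ∀ i {s} → m i ≡ just s → deviant c i ≡ s

complete : (Fin 2 → Maybe Side) → Config
complete m = fromMaybe A (m zero) , fromMaybe A (m (suc zero))

complete-respects : ∀ m → Respects (complete m) m
complete-respects m zero       eq rewrite eq = refl
complete-respects m (suc zero) eq rewrite eq = refl

respecting-configs-answer-alike : ∀ {c c'} q h →
                                  Respects c (commitAfter q h) → Respects c' (commitAfter q h) →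
                                  answer (configInstance c) q ≡ answer (configInstance c') q
respecting-configs-answer-alike {c} {c'} q h respects respects' = answer-determined _ _ q agree
  where
  agree : ∀ σ → concerns q ≡ just σ → deviation c σ ≡ deviation c' σ
  agree (i , s) concerned with concerned-committed q h i concerned
  ... | t , committed =
    cong (λ d → does (s ≟ˢ d)) (trans (respects i committed) (sym (respects' i committed)))

adversary : ∀ alg k h → ∃[ c ] Respects c (commitment h) ×
            (∀ {h' v} → run alg (configInstance c) identity k h ≡ just (h' , v) → Respects c (commitment h'))
adversary alg zero    h = complete (commitment h) , complete-respects _ , λ ()
adversary alg (suc k) h with alg 2 identity h
... | stop v = complete (commitment h) , complete-respects _ , λ { refl → complete-respects _ }
... | ask q
  with adversary alg k ((q , answer (configInstance (complete (commitAfter q h))) q) ∷ h)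
...  | c , respects , final =
  c , (λ i eq → respects i (cong (_<∣> sideQueried q i) eq))
    , final ∘ subst (λ r → run alg (configInstance c) identity k ((q , r) ∷ h) ≡ just _)
                    (respecting-configs-answer-alike q h respects (complete-respects _))

every-slot-queried : ∀ c h → Consistent (configInstance c) h → ProvesStable identity h →
                     Respects c (commitment h) → ∀ σ → Queried σ h
every-slot-queried c h consistent proves respects (i , s) =
  side-cases (λ s → Queried (i , s) h) (deviant c i) deviant-queried guard-queried s
  where
  guard-queried : Queried (i , other (deviant c i)) h
  guard-queried = decidable-stable (queried? _ h) λ unasked →
    unasked-guard-allows-blocking c h i unasked consistent proves
  deviant-queried : Queried (i , deviant c i) h
  deviant-queried with queried-committed h i guard-queried
  ... | t , committed =
    subst (λ t → Queried (i , t) h) (sym (respects i committed)) (committed-queried h i committed)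

too-many-queries : ∀ {p q ℓ} → p < 2 * q → 4 ≤ ℓ → ¬ (ℓ * q ≤ p * 2)
too-many-queries {p} {q} {ℓ} p<2q 4≤ℓ ℓq≤2p = <-irrefl refl (begin-strict
  p * 2       <⟨ *-monoˡ-< 2 p<2q ⟩
  2 * q * 2   ≡⟨ *-comm (2 * q) 2 ⟩
  2 * (2 * q) ≡⟨ sym (*-assoc 2 2 q) ⟩
  4 * q       ≤⟨ *-monoˡ-≤ q 4≤ℓ ⟩
  ℓ * q       ≤⟨ ℓq≤2p ⟩
  p * 2       ∎)
  where open ≤-Reasoning

theorem14 : ∀ (p q : ℕ) → p < 2 * q → ∀ (alg : Algorithm) → ¬ Competitive p q alg
-- The adversary's configuration depends on the fuel, so the fuel is first chosen large enough
-- for every configuration.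
theorem14 p q p<2q alg (correct , competitive) =
  let (K , verifiedWithinK) = common-bound (VerifiesWithin alg identity ∘ configInstance)
                                           (verifiesWithin-mono alg)
                                           (correct 2 identity ∘ configInstance) allConfigs
      (c , _ , adversarial)    = adversary alg K []
      (h , v , ran , verified) = All.lookup verifiedWithinK (∈-allConfigs c)
      stable     = configInstance-stable c
      consistent = run-consistent alg (configInstance c) identity K [] ran
      proves     = proj₁ verified (stable-verdict {M = identity} verified consistent stable)
      queried    = every-slot-queried c h consistent proves (adversarial ran)
  in too-many-queries p<2q (four-slots-queried queried)
       (competitive 2 identity (configInstance c) stable K h v ran (certificate c) (certifies c))
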